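{- The external weakening rule $(ew)$: from $\mathcal{G}/\!/\mathcal{H}$ infer $\mathcal{G}/\!/\ \vdash\ /\!/\mathcal{H}$ (inserting an empty component $\ \vdash\ $ between the possibly empty sequences of components $\mathcal{G}$ and $\mathcal{H}$), is admissible in $\mathsf{LNIF}$: if the premise is derivable in $\mathsf{LNIF}$, so is the conclusion.
   Context: Formulae are first-order over $\bot,\land,\lor,\supset,\forall,\exists$; in sequents bound variables $x,y,\dots$ are distinct from parameters $a,b,\dots$, which occupy all free positions; $A[a/x]$ replaces free occurrences of $x$ by $a$; $p(\vec a)$ is an atomic formula with parameters $\vec a$. A linear nested sequent is $\Gamma_1\vdash\Delta_1 /\!/ \cdots /\!/ \Gamma_n\vdash\Delta_n$ ($n\ge1$), each $\Gamma_i,\Delta_i$ a finite, possibly empty, multiset of formulae (a component). In rule schemas, $\mathcal{G},\mathcal{H},\mathcal{F}$ denote possibly empty sequences of components. $\mathsf{LNIF}$ has the rules (from premise(s) infer conclusion): Initial: $(id_1)$ $\mathcal{G}/\!/\Gamma,p(\vec a)\vdash p(\vec a),\Delta/\!/\mathcal{H}$; $(id_2)$ $\mathcal{G}/\!/\Gamma_1,p(\vec a)\vdash\Delta_1/\!/\mathcal{H}/\!/\Gamma_2\vdash p(\vec a),\Delta_2/\!/\mathcal{F}$; $(\bot_l)$ $\mathcal{G}/\!/\Gamma,\bot\vdash\Delta/\!/\mathcal{H}$. $(\land_l)$: from $\mathcal{G}/\!/\Gamma,A,B\vdash\Delta/\!/\mathcal{H}$ infer $\mathcal{G}/\!/\Gamma,A\land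 B\vdash\Delta/\!/\mathcal{H}$. $(\lor_r)$: from $\mathcal{G}/\!/\Gamma\vdash\Delta,A,B/\!/\mathcal{H}$ infer $\mathcal{G}/\!/\Gamma\vdash\Delta,A\lor B/\!/\mathcal{H}$. $(\land_r)$: from $\mathcal{G}/\!/\Gamma\vdash\Delta,A/\!/\mathcal{H}$ and $\mathcal{G}/\!/\Gamma\vdash\Delta,B/\!/\mathcal{H}$ infer $\mathcal{G}/\!/\Gamma\vdash\Delta,A\land B/\!/\mathcal{H}$. $(\lor_l)$: from $\mathcal{G}/\!/\Gamma,A\vdash\Delta/\!/\mathcal{H}$ and $\mathcal{G}/\!/\Gamma,B\vdash\Delta/\!/\mathcal{H}$ infer $\mathcal{G}/\!/\Gamma,A\lor B\vdash\Delta/\!/\mathcal{H}$. $(\supset_{r1})$: from $\mathcal{G}/\!/\Gamma\vdash\Delta/\!/A\vdash B$ infer $\mathcal{G}/\!/\Gamma\vdash\Delta,A\supset B$. $(\supset_l)$: from $\mathcal{G}/\!/\Gamma,B\vdash\Delta/\!/\mathcal{H}$ and $\mathcal{G}/\!/\Gamma,A\supset B\vdash A,\Delta/\!/\mathcal{H}$ infer $\mathcal{G}/\!/\Gamma,A\supset B\vdash\Delta/\!/\mathcal{H}$. $(lift)$: from $\mathcal{G}/\!/\Gamma_1,A\vdash\Delta_1/\!/\Gamma_2,A\vdash\Delta_2/\!/\mathcal{H}$ infer $\mathcal{G}/\!/\Gamma_1,A\vdash\Delta_1/\!/\Gamma_2\vdash\Delta_2/\!/\mathcal{H}$. $(\forall_l)$: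 from $\mathcal{G}/\!/\Gamma,A[a/x],\forall xA\vdash\Delta/\!/\mathcal{H}$ infer $\mathcal{G}/\!/\Gamma,\forall xA\vdash\Delta/\!/\mathcal{H}$ ($a$ any parameter). $(\forall_{r1})$: from $\mathcal{G}/\!/\Gamma\vdash\Delta/\!/\ \vdash A[a/x]$ infer $\mathcal{G}/\!/\Gamma\vdash\Delta,\forall xA$. $(\exists_l)$: from $\mathcal{G}/\!/\Gamma,A[a/x]\vdash\Delta/\!/\mathcal{H}$ infer $\mathcal{G}/\!/\Gamma,\exists xA\vdash\Delta/\!/\mathcal{H}$. $(\exists_r)$: from $\mathcal{G}/\!/\Gamma\vdash A[a/x],\exists xA,\Delta/\!/\mathcal{H}$ infer $\mathcal{G}/\!/\Gamma\vdash\exists xA,\Delta/\!/\mathcal{H}$ ($a$ any parameter). $(\supset_{r2})$: from $\mathcal{G}/\!/\Gamma_1\vdash\Delta_1/\!/A\vdash B/\!/\Gamma_2\vdash\Delta_2/\!/\mathcal{H}$ and $\mathcal{G}/\!/\Gamma_1\vdash\Delta_1/\!/\Gamma_2\vdash\Delta_2,A\supset B/\!/\mathcal{H}$ infer $\mathcal{G}/\!/\Gamma_1\vdash\Delta_1,A\supset B/\!/\Gamma_2\vdash\Delta_2/\!/\mathcal{H}$. $(\forall_{r2})$: from $\mathcal{G}/\!/\Gamma_1\vdash\Delta_1/\!/\ \vdash A[a/x]/\!/\Gamma_2\vdash\Delta_2/\!/\mathcal{H}$ and $\mathcal{G}/\!/\Gamma_1\vdash\Delta_1/\!/\Gamma_2\vdash\Delta_2,\forall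 xA/\!/\mathcal{H}$ infer $\mathcal{G}/\!/\Gamma_1\vdash\Delta_1,\forall xA/\!/\Gamma_2\vdash\Delta_2/\!/\mathcal{H}$. In $(\forall_{r1}),(\exists_l),(\forall_{r2})$, $a$ is an eigenvariable (does not occur in the conclusion). -}

module Defs where

open import Data.Nat using (ℕ; _≟_)
open import Data.List using (List; []; _∷_; _++_; [_]; concatMap)
open import Data.List.Membership.Propositional using (_∈_)
open import Data.List.Relation.Unary.All using (All)
open import Data.List.Relation.Binary.Permutation.Propositional using (_↭_)
open import Data.List.Relation.Binary.Pointwise using (Pointwise)
open import Data.Product using (_×_)
open import Data.Unit using (⊤)
open import Relation.Nullary using (¬_; yes; no)

data Term : Set where
  var : ℕ → Term
  par : ℕ → Term

data Fm : Set where
  atom : ℕ → List Term → Fm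
  ⊥'   : Fm
  _∧'_ : Fm → Fm → Fm
  _∨'_ : Fm → Fm → Fm
  _⊃'_ : Fm → Fm → Fm
  ∀'   : ℕ → Fm → Fm
  ∃'   : ℕ → Fm → Fm

substT : ℕ → ℕ → Term → Term
substT a x (var y) with x ≟ y
... | yes _ = par a
... | no  _ = var y
substT a x (par b) = par b

substTs : ℕ → ℕ → List Term → List Term
substTs a x []       = []
substTs a x (t ∷ ts) = substT a x t ∷ substTs a x ts

_[_/_] : Fm → ℕ → ℕ → Fm
atom p ts [ a / x ] = atom p (substTs a x ts)
⊥'        [ a / x ] = ⊥'
(A ∧' B)  [ a / x ] = (A [ a / x ]) ∧' (B [ a / x ])
(A ∨' B)  [ a / x ] = (A [ a / x ]) ∨' (B [ a / x ])
(A ⊃' B)  [ a / x ] = (A [ a / x ]) ⊃' (B [ a / x ])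
∀' y A    [ a / x ] with x ≟ y
... | yes _ = ∀' y A
... | no  _ = ∀' y (A [ a / x ])
∃' y A    [ a / x ] with x ≟ y
... | yes _ = ∃' y A
... | no  _ = ∃' y (A [ a / x ])

paramsT : List Term → List ℕ
paramsT []            = []
paramsT (var _ ∷ ts)  = paramsT ts
paramsT (par a ∷ ts)  = a ∷ paramsT ts

params : Fm → List ℕ
params (atom _ ts) = paramsT ts
params ⊥'          = []
params (A ∧' B)    = params A ++ params B
params (A ∨' B)    = params A ++ params B
params (A ⊃' B)    = params A ++ params B
params (∀' _ A)    = params A
params (∃' _ A)    = params A

-- well-formedness: every bound variable is bound (free positions hold parameters only)
TermOK : List ℕ → Term → Set
TermOK bs (var x) = x ∈ bs
TermOK bs (par _) = ⊤

ClosedUnder : List ℕ → Fm → Set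
ClosedUnder bs (atom _ ts) = All (TermOK bs) ts
ClosedUnder bs ⊥'          = ⊤
ClosedUnder bs (A ∧' B)    = ClosedUnder bs A × ClosedUnder bs B
ClosedUnder bs (A ∨' B)    = ClosedUnder bs A × ClosedUnder bs B
ClosedUnder bs (A ⊃' B)    = ClosedUnder bs A × ClosedUnder bs B
ClosedUnder bs (∀' x A)    = ClosedUnder (x ∷ bs) A
ClosedUnder bs (∃' x A)    = ClosedUnder (x ∷ bs) A

Closed : Fm → Set
Closed = ClosedUnder []

-- Components Γ ⊢ Δ (multisets represented as lists, taken up to permutation)
infix 4 _⊢_
record Comp : Set where
  constructor _⊢_
  field
    ant : List Fm
    suc : List Fm
open Comp public

-- linear nested sequent: list of components (c₁ // ... // cₙ)
LNS : Set
LNS = List Comp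

paramsC : Comp → List ℕ
paramsC (Γ ⊢ Δ) = concatMap params Γ ++ concatMap params Δ

paramsS : LNS → List ℕ
paramsS = concatMap paramsC

ClosedS : LNS → Set
ClosedS = All (λ c → All Closed (ant c) × All Closed (suc c))

_≈C_ : Comp → Comp → Set
c ≈C d = (ant c ↭ ant d) × (suc c ↭ suc d)

_≈S_ : LNS → LNS → Set
_≈S_ = Pointwise _≈C_

-- derivability in LNIF.  Γ , A is written A ∷ Γ; the constructor `mset` makes
-- components multisets (every rule applies up to reordering within components).
data LNIF : LNS → Set where
  mset  : ∀ {S T} → S ≈S T → LNIF S → LNIF T
  id₁   : ∀ G H Γ Δ p ts → LNIF (G ++ (atom p ts ∷ Γ ⊢ atom p ts ∷ Δ) ∷ H)
  id₂   : ∀ G H F Γ₁ Δ₁ Γ₂ Δ₂ p ts →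
          LNIF (G ++ (atom p ts ∷ Γ₁ ⊢ Δ₁) ∷ H ++ (Γ₂ ⊢ atom p ts ∷ Δ₂) ∷ F)
  ⊥l    : ∀ G H Γ Δ → LNIF (G ++ (⊥' ∷ Γ ⊢ Δ) ∷ H)
  ∧l    : ∀ G H Γ Δ A B → LNIF (G ++ (A ∷ B ∷ Γ ⊢ Δ) ∷ H) →
          LNIF (G ++ ((A ∧' B) ∷ Γ ⊢ Δ) ∷ H)
  ∨r    : ∀ G H Γ Δ A B → LNIF (G ++ (Γ ⊢ A ∷ B ∷ Δ) ∷ H) →
          LNIF (G ++ (Γ ⊢ (A ∨' B) ∷ Δ) ∷ H)
  ∧r    : ∀ G H Γ Δ A B → LNIF (G ++ (Γ ⊢ A ∷ Δ) ∷ H) → LNIF (G ++ (Γ ⊢ B ∷ Δ) ∷ H) →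
          LNIF (G ++ (Γ ⊢ (A ∧' B) ∷ Δ) ∷ H)
  ∨l    : ∀ G H Γ Δ A B → LNIF (G ++ (A ∷ Γ ⊢ Δ) ∷ H) → LNIF (G ++ (B ∷ Γ ⊢ Δ) ∷ H) →
          LNIF (G ++ ((A ∨' B) ∷ Γ ⊢ Δ) ∷ H)
  ⊃r₁   : ∀ G Γ Δ A B → LNIF (G ++ (Γ ⊢ Δ) ∷ ([ A ] ⊢ [ B ]) ∷ []) →
          LNIF (G ++ (Γ ⊢ (A ⊃' B) ∷ Δ) ∷ [])
  ⊃l    : ∀ G H Γ Δ A B → LNIF (G ++ (B ∷ Γ ⊢ Δ) ∷ H) →
          LNIF (G ++ ((A ⊃' B) ∷ Γ ⊢ A ∷ Δ) ∷ H) →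
          LNIF (G ++ ((A ⊃' B) ∷ Γ ⊢ Δ) ∷ H)
  lift  : ∀ G H Γ₁ Δ₁ Γ₂ Δ₂ A → LNIF (G ++ (A ∷ Γ₁ ⊢ Δ₁) ∷ (A ∷ Γ₂ ⊢ Δ₂) ∷ H) →
          LNIF (G ++ (A ∷ Γ₁ ⊢ Δ₁) ∷ (Γ₂ ⊢ Δ₂) ∷ H)
  ∀l    : ∀ G H Γ Δ x A a → LNIF (G ++ ((A [ a / x ]) ∷ ∀' x A ∷ Γ ⊢ Δ) ∷ H) →
          LNIF (G ++ (∀' x A ∷ Γ ⊢ Δ) ∷ H)
  ∀r₁   : ∀ G Γ Δ x A a → ¬ (a ∈ paramsS (G ++ (Γ ⊢ ∀' x A ∷ Δ) ∷ [])) →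
          LNIF (G ++ (Γ ⊢ Δ) ∷ ([] ⊢ [ A [ a / x ] ]) ∷ []) →
          LNIF (G ++ (Γ ⊢ ∀' x A ∷ Δ) ∷ [])
  ∃l    : ∀ G H Γ Δ x A a → ¬ (a ∈ paramsS (G ++ (∃' x A ∷ Γ ⊢ Δ) ∷ H)) →
          LNIF (G ++ ((A [ a / x ]) ∷ Γ ⊢ Δ) ∷ H) →
          LNIF (G ++ (∃' x A ∷ Γ ⊢ Δ) ∷ H)
  ∃r    : ∀ G H Γ Δ x A a → LNIF (G ++ (Γ ⊢ (A [ a / x ]) ∷ ∃' x A ∷ Δ) ∷ H) →
          LNIF (G ++ (Γ ⊢ ∃' x A ∷ Δ) ∷ H)
  ⊃r₂   : ∀ G H Γ₁ Δ₁ Γ₂ Δ₂ A B →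
          LNIF (G ++ (Γ₁ ⊢ Δ₁) ∷ ([ A ] ⊢ [ B ]) ∷ (Γ₂ ⊢ Δ₂) ∷ H) →
          LNIF (G ++ (Γ₁ ⊢ Δ₁) ∷ (Γ₂ ⊢ (A ⊃' B) ∷ Δ₂) ∷ H) →
          LNIF (G ++ (Γ₁ ⊢ (A ⊃' B) ∷ Δ₁) ∷ (Γ₂ ⊢ Δ₂) ∷ H)
  ∀r₂   : ∀ G H Γ₁ Δ₁ Γ₂ Δ₂ x A a →
          ¬ (a ∈ paramsS (G ++ (Γ₁ ⊢ ∀' x A ∷ Δ₁) ∷ (Γ₂ ⊢ Δ₂) ∷ H)) →
          LNIF (G ++ (Γ₁ ⊢ Δ₁) ∷ ([] ⊢ [ A [ a / x ] ]) ∷ (Γ₂ ⊢ Δ₂) ∷ H) →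
          LNIF (G ++ (Γ₁ ⊢ Δ₁) ∷ (Γ₂ ⊢ ∀' x A ∷ Δ₂) ∷ H) →
          LNIF (G ++ (Γ₁ ⊢ ∀' x A ∷ Δ₁) ∷ (Γ₂ ⊢ Δ₂) ∷ H)

-- We show more generally that a component Σ ⊢ with an arbitrary antecedent Σ
-- can be inserted at any position of a derivable sequent, by induction on the
-- derivation.  The generalisation is forced by (lift): when the new component
-- falls between the two components of a lift, it first receives a copy of the
-- lifted formula, which is then lifted out of it again.  Likewise (⊃r₁) and
-- (∀r₁) turn into (⊃r₂) and (∀r₂) when the component is appended at the end.
-- Since Σ may mention the eigenvariable b of an (∃l), (∀r₁) or (∀r₂) inference,
-- those cases insert instead the copy of Σ in which b is swapped with a fresh
-- parameter, and undo the swap afterwards: derivability is invariant under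
-- injective renamings of parameters.
module Submission where

open import Defs hiding (suc)
open import Data.Nat using (ℕ; zero; suc; _+_; _≟_; s≤s)
open import Data.Nat.Properties using (>⇒≢)
open import Data.List using (List; []; _∷_; _++_; [_]; _∷ʳ_; map; length)
open import Data.List.Properties using (map-++; map-∘; map-cong; map-id; map-id-local; ∷ʳ-++)
open import Data.List.Extrema.Nat using (max; xs≤max)
open import Data.List.Membership.Propositional using (_∉_)
open import Data.List.Relation.Unary.All as All using (All; []; _∷_)
open import Data.List.Relation.Unary.All.Properties using (++⁺; ++⁻; map⁺; map⁻; concat⁺; concat⁻; ++⁻ˡ; ++⁻ʳ; All¬⇒¬Any; ¬Any⇒All¬)
open import Data.List.Relation.Binary.Permutation.Propositional using (↭-refl)
import Data.List.Relation.Binary.Permutation.Propositional.Properties as Perm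
open import Data.List.Relation.Binary.Pointwise as Pointwise using ([]; _∷_)
open import Data.Product using (∃; ∃₂; _×_; _,_; proj₁; proj₂)
open import Data.Empty using (⊥-elim)
open import Function using (_∘_; Injective)
open import Relation.Nullary using (yes; no)
open import Relation.Binary.PropositionalEquality
  using (_≡_; _≢_; refl; sym; trans; cong; cong₂; subst)

-- Renaming of parameters

renameT : (ℕ → ℕ) → Term → Term
renameT ρ (var x) = var x
renameT ρ (par a) = par (ρ a)

renameF : (ℕ → ℕ) → Fm → Fm
renameF ρ (atom p ts) = atom p (map (renameT ρ) ts)
renameF ρ ⊥'          = ⊥'
renameF ρ (A ∧' B)    = renameF ρ A ∧' renameF ρ B
renameF ρ (A ∨' B)    = renameF ρ A ∨' renameF ρ B
renameF ρ (A ⊃' B)    = renameF ρ A ⊃' renameF ρ B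
renameF ρ (∀' x A)    = ∀' x (renameF ρ A)
renameF ρ (∃' x A)    = ∃' x (renameF ρ A)

renameC : (ℕ → ℕ) → Comp → Comp
renameC ρ (Γ ⊢ Δ) = map (renameF ρ) Γ ⊢ map (renameF ρ) Δ

renameS : (ℕ → ℕ) → LNS → LNS
renameS ρ = map (renameC ρ)

renameT-substT : ∀ ρ a x t → renameT ρ (substT a x t) ≡ substT (ρ a) x (renameT ρ t)
renameT-substT ρ a x (var y) with x ≟ y
... | yes _ = refl
... | no  _ = refl
renameT-substT ρ a x (par b) = refl

renameF-subst : ∀ ρ A a x → renameF ρ (A [ a / x ]) ≡ renameF ρ A [ ρ a / x ]
renameF-subst ρ (atom p ts) a x = cong (atom p) (renameTs-substTs ts)
  where
  renameTs-substTs : ∀ ts → map (renameT ρ) (substTs a x ts) ≡ substTs (ρ a) x (map (renameT ρ) ts)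
  renameTs-substTs []       = refl
  renameTs-substTs (t ∷ ts) = cong₂ _∷_ (renameT-substT ρ a x t) (renameTs-substTs ts)
renameF-subst ρ ⊥'       a x = refl
renameF-subst ρ (A ∧' B) a x = cong₂ _∧'_ (renameF-subst ρ A a x) (renameF-subst ρ B a x)
renameF-subst ρ (A ∨' B) a x = cong₂ _∨'_ (renameF-subst ρ A a x) (renameF-subst ρ B a x)
renameF-subst ρ (A ⊃' B) a x = cong₂ _⊃'_ (renameF-subst ρ A a x) (renameF-subst ρ B a x)
renameF-subst ρ (∀' y A) a x with x ≟ y
... | yes _ = refl
... | no  _ = cong (∀' y) (renameF-subst ρ A a x)
renameF-subst ρ (∃' y A) a x with x ≟ y
... | yes _ = refl
... | no  _ = cong (∃' y) (renameF-subst ρ A a x)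

paramsT-renameT : ∀ ρ ts → paramsT (map (renameT ρ) ts) ≡ map ρ (paramsT ts)
paramsT-renameT ρ []           = refl
paramsT-renameT ρ (var _ ∷ ts) = paramsT-renameT ρ ts
paramsT-renameT ρ (par a ∷ ts) = cong (ρ a ∷_) (paramsT-renameT ρ ts)

params-renameF : ∀ ρ A → params (renameF ρ A) ≡ map ρ (params A)
params-renameF-++ : ∀ ρ A B → params (renameF ρ A) ++ params (renameF ρ B) ≡ map ρ (params A ++ params B)
params-renameF ρ (atom p ts) = paramsT-renameT ρ ts
params-renameF ρ ⊥'          = refl
params-renameF ρ (A ∧' B)    = params-renameF-++ ρ A B
params-renameF ρ (A ∨' B)    = params-renameF-++ ρ A B
params-renameF ρ (A ⊃' B)    = params-renameF-++ ρ A B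
params-renameF ρ (∀' x A)    = params-renameF ρ A
params-renameF ρ (∃' x A)    = params-renameF ρ A

params-renameF-++ ρ A B =
  trans (cong₂ _++_ (params-renameF ρ A) (params-renameF ρ B)) (sym (map-++ ρ (params A) (params B)))

map-inverse : ∀ {A : Set} {f g : A → A} → (∀ x → g (f x) ≡ x) → ∀ xs → map g (map f xs) ≡ xs
map-inverse inv xs = trans (sym (map-∘ xs)) (trans (map-cong inv xs) (map-id xs))

renameT-inverse : ∀ {ρ π} → (∀ a → π (ρ a) ≡ a) → ∀ t → renameT π (renameT ρ t) ≡ t
renameT-inverse inv (var x) = refl
renameT-inverse inv (par a) = cong par (inv a)

renameF-inverse : ∀ {ρ π} → (∀ a → π (ρ a) ≡ a) → ∀ A → renameF π (renameF ρ A) ≡ A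
renameF-inverse inv (atom p ts) = cong (atom p) (map-inverse (renameT-inverse inv) ts)
renameF-inverse inv ⊥'          = refl
renameF-inverse inv (A ∧' B)    = cong₂ _∧'_ (renameF-inverse inv A) (renameF-inverse inv B)
renameF-inverse inv (A ∨' B)    = cong₂ _∨'_ (renameF-inverse inv A) (renameF-inverse inv B)
renameF-inverse inv (A ⊃' B)    = cong₂ _⊃'_ (renameF-inverse inv A) (renameF-inverse inv B)
renameF-inverse inv (∀' x A)    = cong (∀' x) (renameF-inverse inv A)
renameF-inverse inv (∃' x A)    = cong (∃' x) (renameF-inverse inv A)

Fixes : (ℕ → ℕ) → List ℕ → Set
Fixes ρ = All (λ a → ρ a ≡ a)

renameT-id-local : ∀ {ρ} ts → Fixes ρ (paramsT ts) → map (renameT ρ) ts ≡ ts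
renameT-id-local []           _          = refl
renameT-id-local (var x ∷ ts) fix        = cong (var x ∷_) (renameT-id-local ts fix)
renameT-id-local (par a ∷ ts) (fa ∷ fix) = cong₂ _∷_ (cong par fa) (renameT-id-local ts fix)

renameF-id-local : ∀ {ρ} A → Fixes ρ (params A) → renameF ρ A ≡ A
renameF-id-local (atom p ts) fix = cong (atom p) (renameT-id-local ts fix)
renameF-id-local ⊥'          fix = refl
renameF-id-local (A ∧' B)    fix = cong₂ _∧'_ (renameF-id-local A (++⁻ˡ _ fix)) (renameF-id-local B (++⁻ʳ _ fix))
renameF-id-local (A ∨' B)    fix = cong₂ _∨'_ (renameF-id-local A (++⁻ˡ _ fix)) (renameF-id-local B (++⁻ʳ _ fix))
renameF-id-local (A ⊃' B)    fix = cong₂ _⊃'_ (renameF-id-local A (++⁻ˡ _ fix)) (renameF-id-local B (++⁻ʳ _ fix))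
renameF-id-local (∀' x A)    fix = cong (∀' x) (renameF-id-local A fix)
renameF-id-local (∃' x A)    fix = cong (∃' x) (renameF-id-local A fix)

renameS-≈S : ∀ ρ {S T} → S ≈S T → renameS ρ S ≈S renameS ρ T
renameS-≈S ρ = Pointwise.map⁺ (renameC ρ) (renameC ρ)
             ∘ Pointwise.map (λ (Γ↭Γ′ , Δ↭Δ′) → Perm.map⁺ (renameF ρ) Γ↭Γ′ , Perm.map⁺ (renameF ρ) Δ↭Δ′)

-- Freshness

_#_ : ℕ → Fm → Set
a # A = All (a ≢_) (params A)

_#ᶜ_ : ℕ → Comp → Set
a #ᶜ (Γ ⊢ Δ) = All (a #_) Γ × All (a #_) Δ

_#ˢ_ : ℕ → LNS → Set
a #ˢ S = All (a #ᶜ_) S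

#ˢ⇒∉ : ∀ {a S} → a #ˢ S → a ∉ paramsS S
#ˢ⇒∉ = All¬⇒¬Any ∘ concat⁺ ∘ map⁺
     ∘ All.map (λ (a#Γ , a#Δ) → ++⁺ (concat⁺ (map⁺ a#Γ)) (concat⁺ (map⁺ a#Δ)))

∉⇒#ˢ : ∀ {a} S → a ∉ paramsS S → a #ˢ S
∉⇒#ˢ S = All.map (λ a∉c → map⁻ (concat⁻ (++⁻ˡ _ a∉c)) , map⁻ (concat⁻ (++⁻ʳ _ a∉c)))
       ∘ map⁻ ∘ concat⁻ ∘ ¬Any⇒All¬ (paramsS S)

fresh : (xs : List ℕ) → ∃ λ a → a ∉ xs
fresh xs = suc (max 0 xs) , All¬⇒¬Any (All.map (λ x≤max → >⇒≢ (s≤s x≤max)) (xs≤max 0 xs))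

#ˢ-renameS : ∀ {ρ a S} → Injective _≡_ _≡_ ρ → a #ˢ S → ρ a #ˢ renameS ρ S
#ˢ-renameS {ρ} inj =
  map⁺ ∘ All.map (λ (a#Γ , a#Δ) → map⁺ (All.map (λ {A} → #-renameF A) a#Γ) , map⁺ (All.map (λ {A} → #-renameF A) a#Δ))
  where
  #-renameF : ∀ {a} A → a # A → ρ a # renameF ρ A
  #-renameF A a#A =
    subst (All _) (sym (params-renameF ρ A)) (map⁺ (All.map (λ a≢b ρa≡ρb → a≢b (inj ρa≡ρb)) a#A))

#ˢ-shift : ∀ {a} G {Γ Δ Σ A} H → a #ˢ (G ++ (Γ ⊢ A ∷ Δ) ∷ (Σ ⊢ []) ∷ H) →
           a #ˢ (G ∷ʳ (Γ ⊢ Δ) ++ (Σ ⊢ A ∷ []) ∷ H)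
#ˢ-shift G H a# with ++⁻ G a#
... | a#G , (a#Γ , a#A ∷ a#Δ) ∷ (a#Σ , []) ∷ a#H =
  ++⁺ (++⁺ a#G ((a#Γ , a#Δ) ∷ [])) ((a#Σ , a#A ∷ []) ∷ a#H)

transpose : ℕ → ℕ → ℕ → ℕ
transpose a b c with c ≟ a
... | yes _ = b
... | no  _ with c ≟ b
...   | yes _ = a
...   | no  _ = c

transpose-matchˡ : ∀ a b → transpose a b a ≡ b
transpose-matchˡ a b with a ≟ a
... | yes _  = refl
... | no a≢a = ⊥-elim (a≢a refl)

transpose-matchʳ : ∀ a b → transpose a b b ≡ a
transpose-matchʳ a b with b ≟ a
... | yes b≡a = b≡a
... | no  _ with b ≟ b
...   | yes _  = refl
...   | no b≢b = ⊥-elim (b≢b refl)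

transpose-fixes : ∀ {a b c} → a ≢ c → b ≢ c → transpose a b c ≡ c
transpose-fixes {a} {b} {c} a≢c b≢c with c ≟ a
... | yes refl = ⊥-elim (a≢c refl)
... | no  _ with c ≟ b
...   | yes refl = ⊥-elim (b≢c refl)
...   | no  _    = refl

transpose-involutive : ∀ a b c → transpose a b (transpose a b c) ≡ c
transpose-involutive a b c with c ≟ a
... | yes refl = transpose-matchʳ c b
... | no  c≢a with c ≟ b
...   | yes refl = transpose-matchˡ a c
...   | no  c≢b  = transpose-fixes (c≢a ∘ sym) (c≢b ∘ sym)

transpose-injective : ∀ a b → Injective _≡_ _≡_ (transpose a b)
transpose-injective a b {c} {d} eq =
  trans (sym (transpose-involutive a b c)) (trans (cong (transpose a b) eq) (transpose-involutive a b d))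

renameS-fixes : ∀ {a b} S → a #ˢ S → b #ˢ S → renameS (transpose a b) S ≡ S
renameS-fixes S a#S b#S = map-id-local (All.zipWith renameC-fixes (a#S , b#S))
  where
  renameF-fixes : ∀ {a b A} → a # A → b # A → renameF (transpose a b) A ≡ A
  renameF-fixes {A = A} a#A b#A =
    renameF-id-local A (All.zipWith (λ (a≢c , b≢c) → transpose-fixes a≢c b≢c) (a#A , b#A))
  renameFs-fixes : ∀ {a b Γ} → All (a #_) Γ → All (b #_) Γ → map (renameF (transpose a b)) Γ ≡ Γ
  renameFs-fixes a#Γ b#Γ = map-id-local (All.zipWith (λ (a#A , b#A) → renameF-fixes a#A b#A) (a#Γ , b#Γ))
  renameC-fixes : ∀ {a b c} → a #ᶜ c × b #ᶜ c → renameC (transpose a b) c ≡ c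
  renameC-fixes ((a#Γ , a#Δ) , (b#Γ , b#Δ)) = cong₂ _⊢_ (renameFs-fixes a#Γ b#Γ) (renameFs-fixes a#Δ b#Δ)

module _ {ρ : ℕ → ℕ} (inj : Injective _≡_ _≡_ ρ) where
  private
    distrib : ∀ G T → renameS ρ (G ++ T) ≡ renameS ρ G ++ renameS ρ T
    distrib G T = map-++ (renameC ρ) G T

    push : ∀ G {T} → LNIF (renameS ρ (G ++ T)) → LNIF (renameS ρ G ++ renameS ρ T)
    push G = subst LNIF (distrib G _)

    pull : ∀ G {T} → LNIF (renameS ρ G ++ renameS ρ T) → LNIF (renameS ρ (G ++ T))
    pull G = subst LNIF (sym (distrib G _))

    fresh-renamed : ∀ {a} G {T} → a ∉ paramsS (G ++ T) → ρ a ∉ paramsS (renameS ρ G ++ renameS ρ T)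
    fresh-renamed G {T} a∉ =
      #ˢ⇒∉ (subst (_ #ˢ_) (distrib G T) (#ˢ-renameS inj (∉⇒#ˢ (G ++ T) a∉)))

  LNIF-renameS : ∀ {S} → LNIF S → LNIF (renameS ρ S)
  LNIF-renameS (mset S≈T d) = mset (renameS-≈S ρ S≈T) (LNIF-renameS d)
  LNIF-renameS (id₁ G H Γ Δ p ts) = pull G (id₁ _ _ _ _ p _)
  LNIF-renameS (id₂ G H F Γ₁ Δ₁ Γ₂ Δ₂ p ts) =
    pull G (subst (λ T → LNIF (renameS ρ G ++ _ ∷ T)) (sym (distrib H _)) (id₂ _ _ _ _ _ _ _ p _))
  LNIF-renameS (⊥l G H Γ Δ) = pull G (⊥l _ _ _ _)
  LNIF-renameS (∧l G H Γ Δ A B d) = pull G (∧l _ _ _ _ _ _ (push G (LNIF-renameS d)))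
  LNIF-renameS (∨r G H Γ Δ A B d) = pull G (∨r _ _ _ _ _ _ (push G (LNIF-renameS d)))
  LNIF-renameS (∧r G H Γ Δ A B d e) =
    pull G (∧r _ _ _ _ _ _ (push G (LNIF-renameS d)) (push G (LNIF-renameS e)))
  LNIF-renameS (∨l G H Γ Δ A B d e) =
    pull G (∨l _ _ _ _ _ _ (push G (LNIF-renameS d)) (push G (LNIF-renameS e)))
  LNIF-renameS (⊃r₁ G Γ Δ A B d) = pull G (⊃r₁ _ _ _ _ _ (push G (LNIF-renameS d)))
  LNIF-renameS (⊃l G H Γ Δ A B d e) =
    pull G (⊃l _ _ _ _ _ _ (push G (LNIF-renameS d)) (push G (LNIF-renameS e)))
  LNIF-renameS (lift G H Γ₁ Δ₁ Γ₂ Δ₂ A d) = pull G (lift _ _ _ _ _ _ _ (push G (LNIF-renameS d)))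
  LNIF-renameS (⊃r₂ G H Γ₁ Δ₁ Γ₂ Δ₂ A B d e) =
    pull G (⊃r₂ _ _ _ _ _ _ _ _ (push G (LNIF-renameS d)) (push G (LNIF-renameS e)))
  LNIF-renameS (∀l G H Γ Δ x A a d) =
    pull G (∀l _ _ _ _ x _ (ρ a) (subst (λ B → LNIF (renameS ρ G ++ (B ∷ _ ⊢ _) ∷ renameS ρ H))
      (renameF-subst ρ A a x) (push G (LNIF-renameS d))))
  LNIF-renameS (∃r G H Γ Δ x A a d) =
    pull G (∃r _ _ _ _ x _ (ρ a) (subst (λ B → LNIF (renameS ρ G ++ (_ ⊢ B ∷ _) ∷ renameS ρ H))
      (renameF-subst ρ A a x) (push G (LNIF-renameS d))))
  LNIF-renameS (∃l G H Γ Δ x A a a∉ d) =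
    pull G (∃l _ _ _ _ x _ (ρ a) (fresh-renamed G a∉)
      (subst (λ B → LNIF (renameS ρ G ++ (B ∷ _ ⊢ _) ∷ renameS ρ H))
        (renameF-subst ρ A a x) (push G (LNIF-renameS d))))
  LNIF-renameS (∀r₁ G Γ Δ x A a a∉ d) =
    pull G (∀r₁ _ _ _ x _ (ρ a) (fresh-renamed G a∉)
      (subst (λ B → LNIF (renameS ρ G ++ _ ∷ ([] ⊢ [ B ]) ∷ []))
        (renameF-subst ρ A a x) (push G (LNIF-renameS d))))
  LNIF-renameS (∀r₂ G H Γ₁ Δ₁ Γ₂ Δ₂ x A a a∉ d e) =
    pull G (∀r₂ _ _ _ _ _ _ x _ (ρ a) (fresh-renamed G a∉)
      (subst (λ B → LNIF (renameS ρ G ++ _ ∷ ([] ⊢ [ B ]) ∷ _ ∷ renameS ρ H))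
        (renameF-subst ρ A a x) (push G (LNIF-renameS d)))
      (push G (LNIF-renameS e)))

-- Inserting a component

insertAt : ℕ → Comp → LNS → LNS
insertAt zero    e S       = e ∷ S
insertAt (suc k) e []      = e ∷ []
insertAt (suc k) e (c ∷ S) = c ∷ insertAt k e S

insertAt-++ : ∀ G j e T → insertAt (length G + j) e (G ++ T) ≡ G ++ insertAt j e T
insertAt-++ []      j e T = refl
insertAt-++ (c ∷ G) j e T = cong (c ∷_) (insertAt-++ G j e T)

insertAt-[] : ∀ j e → insertAt j e [] ≡ [ e ]
insertAt-[] zero    e = refl
insertAt-[] (suc j) e = refl

insertAt-≈S : ∀ k e {S T} → S ≈S T → insertAt k e S ≈S insertAt k e T
insertAt-≈S zero    e S≈T         = (↭-refl , ↭-refl) ∷ S≈T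
insertAt-≈S (suc k) e []          = (↭-refl , ↭-refl) ∷ []
insertAt-≈S (suc k) e (c≈d ∷ S≈T) = c≈d ∷ insertAt-≈S k e S≈T

insertAt⁺ : ∀ {P : Comp → Set} k {e S} → P e → All P S → All P (insertAt k e S)
insertAt⁺ zero    pe pS        = pe ∷ pS
insertAt⁺ (suc k) pe []        = pe ∷ []
insertAt⁺ (suc k) pe (pc ∷ pS) = pc ∷ insertAt⁺ k pe pS

renameS-insertAt : ∀ ρ k e S → renameS ρ (insertAt k e S) ≡ insertAt k (renameC ρ e) (renameS ρ S)
renameS-insertAt ρ zero    e S       = refl
renameS-insertAt ρ (suc k) e []      = refl
renameS-insertAt ρ (suc k) e (c ∷ S) = cong (renameC ρ c ∷_) (renameS-insertAt ρ k e S)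

data Position (k : ℕ) (e : Comp) (G : LNS) : Set where
  within : ∀ G′ → (∀ T → insertAt k e (G ++ T) ≡ G′ ++ T) → Position k e G
  beyond : ∀ j → (∀ c H → insertAt k e (G ++ c ∷ H) ≡ G ++ c ∷ insertAt j e H) → Position k e G

position : ∀ k e G → Position k e G
position zero    e G       = within (e ∷ G) (λ _ → refl)
position (suc k) e []      = beyond k (λ _ _ → refl)
position (suc k) e (c ∷ G) with position k e G
... | within G′ eq = within (c ∷ G′) (cong (c ∷_) ∘ eq)
... | beyond j  eq = beyond j (λ d H → cong (c ∷_) (eq d H))

focus : ∀ k e G H → ∃₂ λ G′ H′ → ∀ c → insertAt k e (G ++ c ∷ H) ≡ G′ ++ c ∷ H′
focus k e G H with position k e G
... | within G′ eq = G′ , H , λ c → eq (c ∷ H)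
... | beyond j  eq = G , insertAt j e H , λ c → eq c H

Insertable : LNS → Set
Insertable S = ∀ k Σ → LNIF (insertAt k (Σ ⊢ []) S)

insertable-++ : ∀ G {T} → Insertable (G ++ T) → ∀ j Σ → LNIF (G ++ insertAt j (Σ ⊢ []) T)
insertable-++ G ins j Σ = subst LNIF (insertAt-++ G j _ _) (ins (length G + j) Σ)

insertable₀ : ∀ {c} → (∀ G H → LNIF (G ++ c ∷ H)) → ∀ G H → Insertable (G ++ c ∷ H)
insertable₀ axiom G H k Σ with focus k (Σ ⊢ []) G H
... | G′ , H′ , eq = subst LNIF (sym (eq _)) (axiom G′ H′)

insertable₁ : ∀ {p c} → (∀ G H → LNIF (G ++ p ∷ H) → LNIF (G ++ c ∷ H)) →
              ∀ G H → Insertable (G ++ p ∷ H) → Insertable (G ++ c ∷ H)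
insertable₁ rule G H ins k Σ with focus k (Σ ⊢ []) G H
... | G′ , H′ , eq = subst LNIF (sym (eq _)) (rule G′ H′ (subst LNIF (eq _) (ins k Σ)))

insertable₂ : ∀ {p q c} → (∀ G H → LNIF (G ++ p ∷ H) → LNIF (G ++ q ∷ H) → LNIF (G ++ c ∷ H)) →
              ∀ G H → Insertable (G ++ p ∷ H) → Insertable (G ++ q ∷ H) → Insertable (G ++ c ∷ H)
insertable₂ rule G H ins₁ ins₂ k Σ with focus k (Σ ⊢ []) G H
... | G′ , H′ , eq =
  subst LNIF (sym (eq _)) (rule G′ H′ (subst LNIF (eq _) (ins₁ k Σ)) (subst LNIF (eq _) (ins₂ k Σ)))

insertable-id₂ : ∀ G H F Γ₁ Δ₁ Γ₂ Δ₂ p ts →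
                 Insertable (G ++ (atom p ts ∷ Γ₁ ⊢ Δ₁) ∷ H ++ (Γ₂ ⊢ atom p ts ∷ Δ₂) ∷ F)
insertable-id₂ G H F Γ₁ Δ₁ Γ₂ Δ₂ p ts k Σ with position k (Σ ⊢ []) G
... | within G′ eq = subst LNIF (sym (eq _)) (id₂ G′ H F Γ₁ Δ₁ Γ₂ Δ₂ p ts)
... | beyond j  eq with focus j (Σ ⊢ []) H F
...   | H′ , F′ , eq′ =
  subst LNIF (sym (trans (eq _ _) (cong (λ T → G ++ _ ∷ T) (eq′ _)))) (id₂ G H′ F′ Γ₁ Δ₁ Γ₂ Δ₂ p ts)

insertable-lift : ∀ G H Γ₁ Δ₁ Γ₂ Δ₂ A →
                  Insertable (G ++ (A ∷ Γ₁ ⊢ Δ₁) ∷ (A ∷ Γ₂ ⊢ Δ₂) ∷ H) →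
                  Insertable (G ++ (A ∷ Γ₁ ⊢ Δ₁) ∷ (Γ₂ ⊢ Δ₂) ∷ H)
insertable-lift G H Γ₁ Δ₁ Γ₂ Δ₂ A ins k Σ with position k (Σ ⊢ []) G
... | within G′ eq = subst LNIF (sym (eq _)) (lift G′ H Γ₁ Δ₁ Γ₂ Δ₂ A (subst LNIF (eq _) (ins k Σ)))
... | beyond (suc j) eq =
  subst LNIF (sym (eq _ _)) (lift G (insertAt j (Σ ⊢ []) H) Γ₁ Δ₁ Γ₂ Δ₂ A (subst LNIF (eq _ _) (ins k Σ)))
... | beyond zero eq =
  subst LNIF (sym (eq _ _)) (lift G ((Γ₂ ⊢ Δ₂) ∷ H) Γ₁ Δ₁ Σ [] A
    (subst LNIF (∷ʳ-++ G _ _) (lift (G ∷ʳ (A ∷ Γ₁ ⊢ Δ₁)) H Σ [] Γ₂ Δ₂ A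
      (subst LNIF (sym (∷ʳ-++ G _ _)) (insertable-++ G ins 1 (A ∷ Σ))))))

insertable-⊃r₁ : ∀ G Γ Δ A B →
                 Insertable (G ++ (Γ ⊢ Δ) ∷ ([ A ] ⊢ [ B ]) ∷ []) →
                 Insertable (G ++ (Γ ⊢ (A ⊃' B) ∷ Δ) ∷ [])
insertable-⊃r₁ G Γ Δ A B ins k Σ with position k (Σ ⊢ []) G
... | within G′ eq = subst LNIF (sym (eq _)) (⊃r₁ G′ Γ Δ A B (subst LNIF (eq _) (ins k Σ)))
... | beyond j  eq =
  subst LNIF (sym (trans (eq _ []) (cong (λ T → G ++ _ ∷ T) (insertAt-[] j _))))
    (⊃r₂ G [] Γ Δ Σ [] A B (insertable-++ G ins 2 Σ)
      (subst LNIF (∷ʳ-++ G _ _) (⊃r₁ (G ∷ʳ (Γ ⊢ Δ)) Σ [] A B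
        (subst LNIF (sym (∷ʳ-++ G _ _)) (insertable-++ G ins 1 Σ)))))

insertable-⊃r₂ : ∀ G H Γ₁ Δ₁ Γ₂ Δ₂ A B →
                 Insertable (G ++ (Γ₁ ⊢ Δ₁) ∷ ([ A ] ⊢ [ B ]) ∷ (Γ₂ ⊢ Δ₂) ∷ H) →
                 Insertable (G ++ (Γ₁ ⊢ Δ₁) ∷ (Γ₂ ⊢ (A ⊃' B) ∷ Δ₂) ∷ H) →
                 Insertable (G ++ (Γ₁ ⊢ (A ⊃' B) ∷ Δ₁) ∷ (Γ₂ ⊢ Δ₂) ∷ H)
insertable-⊃r₂ G H Γ₁ Δ₁ Γ₂ Δ₂ A B ins₁ ins₂ k Σ with position k (Σ ⊢ []) G
... | within G′ eq =
  subst LNIF (sym (eq _))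
    (⊃r₂ G′ H Γ₁ Δ₁ Γ₂ Δ₂ A B (subst LNIF (eq _) (ins₁ k Σ)) (subst LNIF (eq _) (ins₂ k Σ)))
... | beyond (suc j) eq =
  subst LNIF (sym (eq _ _)) (⊃r₂ G (insertAt j (Σ ⊢ []) H) Γ₁ Δ₁ Γ₂ Δ₂ A B
    (insertable-++ G ins₁ (3 + j) Σ) (insertable-++ G ins₂ (2 + j) Σ))
... | beyond zero eq =
  subst LNIF (sym (eq _ _)) (⊃r₂ G ((Γ₂ ⊢ Δ₂) ∷ H) Γ₁ Δ₁ Σ [] A B (insertable-++ G ins₁ 2 Σ)
    (subst LNIF (∷ʳ-++ G _ _) (⊃r₂ (G ∷ʳ (Γ₁ ⊢ Δ₁)) H Σ [] Γ₂ Δ₂ A B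
      (subst LNIF (sym (∷ʳ-++ G _ _)) (insertable-++ G ins₁ 1 Σ))
      (subst LNIF (sym (∷ʳ-++ G _ _)) (insertable-++ G ins₂ 1 Σ)))))

insertable-avoiding : ∀ {b} S → b ∉ paramsS S →
                      (∀ k Σ → b #ˢ insertAt k (Σ ⊢ []) S → LNIF (insertAt k (Σ ⊢ []) S)) →
                      Insertable S
insertable-avoiding {b} S b∉S ins k Σ =
  subst LNIF renamed-back (LNIF-renameS (transpose-injective f b) (ins k Σ′ (insertAt⁺ k (b#Σ′ , []) b#S)))
  where
  f : ℕ
  f = proj₁ (fresh (paramsS ((Σ ⊢ []) ∷ S)))
  f#ΣS : f #ˢ ((Σ ⊢ []) ∷ S)
  f#ΣS = ∉⇒#ˢ _ (proj₂ (fresh _))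
  b#S : b #ˢ S
  b#S = ∉⇒#ˢ S b∉S
  Σ′ : List Fm
  Σ′ = map (renameF (transpose f b)) Σ
  b#Σ′ : All (b #_) Σ′
  b#Σ′ = subst (λ a → All (a #_) Σ′) (transpose-matchˡ f b)
               (proj₁ (All.head (#ˢ-renameS (transpose-injective f b) f#ΣS)))
  renamed-back : renameS (transpose f b) (insertAt k (Σ′ ⊢ []) S) ≡ insertAt k (Σ ⊢ []) S
  renamed-back = trans (renameS-insertAt (transpose f b) k _ S)
    (cong₂ (λ Γ T → insertAt k (Γ ⊢ []) T)
      (map-inverse (renameF-inverse (transpose-involutive f b)) Σ) (renameS-fixes S (All.tail f#ΣS) b#S))

insertable-∃l : ∀ G H Γ Δ x A b → b ∉ paramsS (G ++ (∃' x A ∷ Γ ⊢ Δ) ∷ H) →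
                Insertable (G ++ ((A [ b / x ]) ∷ Γ ⊢ Δ) ∷ H) →
                Insertable (G ++ (∃' x A ∷ Γ ⊢ Δ) ∷ H)
insertable-∃l G H Γ Δ x A b b∉ ins = insertable-avoiding _ b∉ avoiding
  where
  avoiding : ∀ k Σ → b #ˢ insertAt k (Σ ⊢ []) (G ++ (∃' x A ∷ Γ ⊢ Δ) ∷ H) →
             LNIF (insertAt k (Σ ⊢ []) (G ++ (∃' x A ∷ Γ ⊢ Δ) ∷ H))
  avoiding k Σ b# with focus k (Σ ⊢ []) G H
  ... | G′ , H′ , eq = subst LNIF (sym (eq _))
    (∃l G′ H′ Γ Δ x A b (#ˢ⇒∉ (subst (b #ˢ_) (eq _) b#)) (subst LNIF (eq _) (ins k Σ)))

insertable-∀r₁ : ∀ G Γ Δ x A b → b ∉ paramsS (G ++ (Γ ⊢ ∀' x A ∷ Δ) ∷ []) →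
                 Insertable (G ++ (Γ ⊢ Δ) ∷ ([] ⊢ [ A [ b / x ] ]) ∷ []) →
                 Insertable (G ++ (Γ ⊢ ∀' x A ∷ Δ) ∷ [])
insertable-∀r₁ G Γ Δ x A b b∉ ins = insertable-avoiding _ b∉ avoiding
  where
  avoiding : ∀ k Σ → b #ˢ insertAt k (Σ ⊢ []) (G ++ (Γ ⊢ ∀' x A ∷ Δ) ∷ []) →
             LNIF (insertAt k (Σ ⊢ []) (G ++ (Γ ⊢ ∀' x A ∷ Δ) ∷ []))
  avoiding k Σ b# with position k (Σ ⊢ []) G
  ... | within G′ eq = subst LNIF (sym (eq _))
    (∀r₁ G′ Γ Δ x A b (#ˢ⇒∉ (subst (b #ˢ_) (eq _) b#)) (subst LNIF (eq _) (ins k Σ)))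
  ... | beyond j  eq = subst LNIF (sym appended)
    (∀r₂ G [] Γ Δ Σ [] x A b (#ˢ⇒∉ b#′) (insertable-++ G ins 2 Σ)
      (subst LNIF (∷ʳ-++ G _ _) (∀r₁ (G ∷ʳ (Γ ⊢ Δ)) Σ [] x A b (#ˢ⇒∉ (#ˢ-shift G [] b#′))
        (subst LNIF (sym (∷ʳ-++ G _ _)) (insertable-++ G ins 1 Σ)))))
    where
    appended : insertAt k (Σ ⊢ []) (G ++ (Γ ⊢ ∀' x A ∷ Δ) ∷ []) ≡ G ++ (Γ ⊢ ∀' x A ∷ Δ) ∷ (Σ ⊢ []) ∷ []
    appended = trans (eq _ []) (cong (λ T → G ++ _ ∷ T) (insertAt-[] j _))
    b#′ : b #ˢ (G ++ (Γ ⊢ ∀' x A ∷ Δ) ∷ (Σ ⊢ []) ∷ [])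
    b#′ = subst (b #ˢ_) appended b#

insertable-∀r₂ : ∀ G H Γ₁ Δ₁ Γ₂ Δ₂ x A b →
                 b ∉ paramsS (G ++ (Γ₁ ⊢ ∀' x A ∷ Δ₁) ∷ (Γ₂ ⊢ Δ₂) ∷ H) →
                 Insertable (G ++ (Γ₁ ⊢ Δ₁) ∷ ([] ⊢ [ A [ b / x ] ]) ∷ (Γ₂ ⊢ Δ₂) ∷ H) →
                 Insertable (G ++ (Γ₁ ⊢ Δ₁) ∷ (Γ₂ ⊢ ∀' x A ∷ Δ₂) ∷ H) →
                 Insertable (G ++ (Γ₁ ⊢ ∀' x A ∷ Δ₁) ∷ (Γ₂ ⊢ Δ₂) ∷ H)
insertable-∀r₂ G H Γ₁ Δ₁ Γ₂ Δ₂ x A b b∉ ins₁ ins₂ = insertable-avoiding _ b∉ avoiding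
  where
  avoiding : ∀ k Σ → b #ˢ insertAt k (Σ ⊢ []) (G ++ (Γ₁ ⊢ ∀' x A ∷ Δ₁) ∷ (Γ₂ ⊢ Δ₂) ∷ H) →
             LNIF (insertAt k (Σ ⊢ []) (G ++ (Γ₁ ⊢ ∀' x A ∷ Δ₁) ∷ (Γ₂ ⊢ Δ₂) ∷ H))
  avoiding k Σ b# with position k (Σ ⊢ []) G
  ... | within G′ eq = subst LNIF (sym (eq _))
    (∀r₂ G′ H Γ₁ Δ₁ Γ₂ Δ₂ x A b (#ˢ⇒∉ (subst (b #ˢ_) (eq _) b#))
      (subst LNIF (eq _) (ins₁ k Σ)) (subst LNIF (eq _) (ins₂ k Σ)))
  ... | beyond (suc j) eq = subst LNIF (sym (eq _ _))
    (∀r₂ G (insertAt j (Σ ⊢ []) H) Γ₁ Δ₁ Γ₂ Δ₂ x A b (#ˢ⇒∉ (subst (b #ˢ_) (eq _ _) b#))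
      (insertable-++ G ins₁ (3 + j) Σ) (insertable-++ G ins₂ (2 + j) Σ))
  ... | beyond zero eq = subst LNIF (sym (eq _ _))
    (∀r₂ G ((Γ₂ ⊢ Δ₂) ∷ H) Γ₁ Δ₁ Σ [] x A b (#ˢ⇒∉ b#′) (insertable-++ G ins₁ 2 Σ)
      (subst LNIF (∷ʳ-++ G _ _) (∀r₂ (G ∷ʳ (Γ₁ ⊢ Δ₁)) H Σ [] Γ₂ Δ₂ x A b (#ˢ⇒∉ (#ˢ-shift G _ b#′))
        (subst LNIF (sym (∷ʳ-++ G _ _)) (insertable-++ G ins₁ 1 Σ))
        (subst LNIF (sym (∷ʳ-++ G _ _)) (insertable-++ G ins₂ 1 Σ)))))
    where
    b#′ : b #ˢ (G ++ (Γ₁ ⊢ ∀' x A ∷ Δ₁) ∷ (Σ ⊢ []) ∷ (Γ₂ ⊢ Δ₂) ∷ H)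
    b#′ = subst (b #ˢ_) (eq _ _) b#

insertable : ∀ {S} → LNIF S → Insertable S
insertable (mset S≈T d) k Σ = mset (insertAt-≈S k _ S≈T) (insertable d k Σ)
insertable (id₁ G H Γ Δ p ts) = insertable₀ (λ G H → id₁ G H Γ Δ p ts) G H
insertable (id₂ G H F Γ₁ Δ₁ Γ₂ Δ₂ p ts) = insertable-id₂ G H F Γ₁ Δ₁ Γ₂ Δ₂ p ts
insertable (⊥l G H Γ Δ) = insertable₀ (λ G H → ⊥l G H Γ Δ) G H
insertable (∧l G H Γ Δ A B d) = insertable₁ (λ G H → ∧l G H Γ Δ A B) G H (insertable d)
insertable (∨r G H Γ Δ A B d) = insertable₁ (λ G H → ∨r G H Γ Δ A B) G H (insertable d)
insertable (∧r G H Γ Δ A B d e) = insertable₂ (λ G H → ∧r G H Γ Δ A B) G H (insertable d) (insertable e)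
insertable (∨l G H Γ Δ A B d e) = insertable₂ (λ G H → ∨l G H Γ Δ A B) G H (insertable d) (insertable e)
insertable (⊃l G H Γ Δ A B d e) = insertable₂ (λ G H → ⊃l G H Γ Δ A B) G H (insertable d) (insertable e)
insertable (∀l G H Γ Δ x A a d) = insertable₁ (λ G H → ∀l G H Γ Δ x A a) G H (insertable d)
insertable (∃r G H Γ Δ x A a d) = insertable₁ (λ G H → ∃r G H Γ Δ x A a) G H (insertable d)
insertable (lift G H Γ₁ Δ₁ Γ₂ Δ₂ A d) = insertable-lift G H Γ₁ Δ₁ Γ₂ Δ₂ A (insertable d)
insertable (⊃r₁ G Γ Δ A B d) = insertable-⊃r₁ G Γ Δ A B (insertable d)
insertable (⊃r₂ G H Γ₁ Δ₁ Γ₂ Δ₂ A B d e) = insertable-⊃r₂ G H Γ₁ Δ₁ Γ₂ Δ₂ A B (insertable d) (insertable e)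
insertable (∃l G H Γ Δ x A a a∉ d) = insertable-∃l G H Γ Δ x A a a∉ (insertable d)
insertable (∀r₁ G Γ Δ x A a a∉ d) = insertable-∀r₁ G Γ Δ x A a a∉ (insertable d)
insertable (∀r₂ G H Γ₁ Δ₁ Γ₂ Δ₂ x A a a∉ d e) = insertable-∀r₂ G H Γ₁ Δ₁ Γ₂ Δ₂ x A a a∉ (insertable d) (insertable e)

lemma6 : (G H : LNS) → ClosedS (G ++ H) → LNIF (G ++ H) →
         LNIF (G ++ ([] ⊢ []) ∷ H)
lemma6 G H _ d = insertable-++ G (insertable d) 0 []
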